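{- Let $\mathcal{G}$ be a hereditary class of graphs that is closed under substitution. Then for all $G\in\mathcal{G}^\#$, there exists a graph $G'\in\mathcal{G}$ such that $G'$ is an induced subgraph of $G$ and $\chi(G')=\chi(G)$.
   Context: Graphs are finite and simple, possibly empty; $\chi$ is the chromatic number. A class is hereditary if closed under isomorphism and induced subgraphs. Substitution: for non-empty graphs $G_1,G_2$ with disjoint vertex sets and $u\in V_{G_1}$, the graph obtained by substituting $G_2$ for $u$ in $G_1$ has vertex set $(V_{G_1}\smallsetminus\{u\})\cup V_{G_2}$, induces $G_1\smallsetminus u$ and $G_2$ on the respective parts, and each $v\in V_{G_1}\smallsetminus\{u\}$ is complete to $V_{G_2}$ if adjacent to $u$ and anti-complete otherwise. Gluing along a clique: for non-empty graphs $G_1,G_2$ with inclusion-wise incomparable vertex sets such that $C=V_{G_1}\cap V_{G_2}$ is a (possibly empty) clique in both and $G_1[C]=G_2[C]$, the graph $G$ with $V_G=V_{G_1}\cup V_{G_2}$, $G[V_{G_i}]=G_i$, and $V_{G_1}\smallsetminus C$ anti-complete to $V_{G_2}\smallsetminus C$. $\mathcal{G}^\#$ is the closure of $\mathcal{G}$ under substitution and gluing along a clique. -}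

module Defs where

open import Data.Nat using (ℕ; zero; suc; _+_; _≤_; _∸_)
open import Data.Fin using (Fin; splitAt; _↑ˡ_; _↑ʳ_; punchIn)
open import Data.Bool using (Bool; true; false)
open import Data.Sum using (_⊎_; inj₁; inj₂)
open import Data.Product using (Σ; _×_; _,_)
open import Relation.Binary.PropositionalEquality using (_≡_; _≢_; refl)
open import Function.Bundles using (_↔_; Inverse)
open import Function.Definitions using (Injective)

record Graph : Set where
  field
    size   : ℕ
    adj    : Fin size → Fin size → Bool
    sym    : ∀ i j → adj i j ≡ adj j i
    irrefl : ∀ i → adj i i ≡ false
open Graph public

Iso : Graph → Graph → Set
Iso G H = Σ (Fin (size G) ↔ Fin (size H)) λ f →
  ∀ i j → adj H (Inverse.to f i) (Inverse.to f j) ≡ adj G i j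

InducedSub : Graph → Graph → Set
InducedSub H G = Σ (Fin (size H) → Fin (size G)) λ f →
  Injective _≡_ _≡_ f × (∀ i j → adj G (f i) (f j) ≡ adj H i j)

Class : Set₁
Class = Graph → Set

Hereditary : Class → Set
Hereditary 𝒢 =
  (∀ G H → Iso G H → 𝒢 G → 𝒢 H) ×
  (∀ G H → InducedSub H G → 𝒢 G → 𝒢 H)

-- Vertex set of the result: Fin (m + suc k), the first m vertices being
-- V(G₁) ∖ {u} (via punchIn u) and the last suc k being V(G₂).

module _ {m k : ℕ} (a₁ : Fin (suc m) → Fin (suc m) → Bool) (u : Fin (suc m))
         (a₂ : Fin (suc k) → Fin (suc k) → Bool) where
  substAdjSum : Fin m ⊎ Fin (suc k) → Fin m ⊎ Fin (suc k) → Bool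
  substAdjSum (inj₁ i) (inj₁ i') = a₁ (punchIn u i) (punchIn u i')
  substAdjSum (inj₁ i) (inj₂ _)  = a₁ (punchIn u i) u
  substAdjSum (inj₂ _) (inj₁ i)  = a₁ (punchIn u i) u
  substAdjSum (inj₂ j) (inj₂ j') = a₂ j j'

substitute : (G₁ : Graph) {m : ℕ} → size G₁ ≡ suc m → Fin (size G₁) →
             (G₂ : Graph) {k : ℕ} → size G₂ ≡ suc k → Graph
substitute record { size = .(suc m) ; adj = a₁ ; sym = s₁ ; irrefl = r₁ } {m} refl u
           record { size = .(suc k) ; adj = a₂ ; sym = s₂ ; irrefl = r₂ } {k} refl =
  record { size = m + suc k ; adj = A ; sym = S ; irrefl = R }
  where
  A : Fin (m + suc k) → Fin (m + suc k) → Bool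
  A x y = substAdjSum a₁ u a₂ (splitAt m x) (splitAt m y)
  S' : ∀ p q → substAdjSum a₁ u a₂ p q ≡ substAdjSum a₁ u a₂ q p
  S' (inj₁ i) (inj₁ i') = s₁ (punchIn u i) (punchIn u i')
  S' (inj₁ i) (inj₂ _)  = refl
  S' (inj₂ _) (inj₁ i)  = refl
  S' (inj₂ j) (inj₂ j') = s₂ j j'
  S : ∀ x y → A x y ≡ A y x
  S x y = S' (splitAt m x) (splitAt m y)
  R' : ∀ p → substAdjSum a₁ u a₂ p p ≡ false
  R' (inj₁ i) = r₁ (punchIn u i)
  R' (inj₂ j) = r₂ j
  R : ∀ x → A x x ≡ false
  R x = R' (splitAt m x)

-- Gluing along a clique.
-- G₁ has vertex set Fin (c + suc a): the first c vertices form C, the rest A.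
-- G₂ has vertex set Fin (c + suc b): the first c vertices form C, the rest B.
-- (A, B non-empty ⇔ the vertex sets are inclusion-wise incomparable.)
-- The result has vertex set Fin (c + (suc a + suc b)) ≅ C ⊎ (A ⊎ B).

IsCliqueOn : (G : Graph) {c r : ℕ} → size G ≡ c + r → Set
IsCliqueOn record { size = .(c + r) ; adj = a } {c} {r} refl =
  ∀ (i j : Fin c) → i ≢ j → a (i ↑ˡ r) (j ↑ˡ r) ≡ true

module _ {c a b : ℕ} (a₁ : Fin (c + suc a) → Fin (c + suc a) → Bool)
         (a₂ : Fin (c + suc b) → Fin (c + suc b) → Bool) where
  data Part : Set where
    inC : Fin c → Part
    inA : Fin (suc a) → Part
    inB : Fin (suc b) → Part

  toPart : Fin (c + (suc a + suc b)) → Part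
  toPart x with splitAt c x
  ... | inj₁ i = inC i
  ... | inj₂ y with splitAt (suc a) y
  ... | inj₁ p = inA p
  ... | inj₂ q = inB q

  glueAdjPart : Part → Part → Bool
  glueAdjPart (inC i) (inC j) = a₁ (i ↑ˡ suc a) (j ↑ˡ suc a)
  glueAdjPart (inC i) (inA p) = a₁ (i ↑ˡ suc a) (c ↑ʳ p)
  glueAdjPart (inA p) (inC i) = a₁ (c ↑ʳ p) (i ↑ˡ suc a)
  glueAdjPart (inA p) (inA p') = a₁ (c ↑ʳ p) (c ↑ʳ p')
  glueAdjPart (inC i) (inB q) = a₂ (i ↑ˡ suc b) (c ↑ʳ q)
  glueAdjPart (inB q) (inC i) = a₂ (c ↑ʳ q) (i ↑ˡ suc b)
  glueAdjPart (inB q) (inB q') = a₂ (c ↑ʳ q) (c ↑ʳ q')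
  glueAdjPart (inA _) (inB _) = false
  glueAdjPart (inB _) (inA _) = false

glue : (G₁ : Graph) {c a : ℕ} → size G₁ ≡ c + suc a →
       (G₂ : Graph) {b : ℕ} → size G₂ ≡ c + suc b → Graph
glue record { size = .(c + suc a) ; adj = a₁ ; sym = s₁ ; irrefl = r₁ } {c} {a} refl
     record { size = .(c + suc b) ; adj = a₂ ; sym = s₂ ; irrefl = r₂ } {b} refl =
  record { size = c + (suc a + suc b) ; adj = A ; sym = S ; irrefl = R }
  where
  P = Part {c} {a} {b} a₁ a₂
  A : Fin (c + (suc a + suc b)) → Fin (c + (suc a + suc b)) → Bool
  A x y = glueAdjPart a₁ a₂ (toPart a₁ a₂ x) (toPart a₁ a₂ y)
  S' : ∀ (p q : P) → glueAdjPart a₁ a₂ p q ≡ glueAdjPart a₁ a₂ q p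
  S' (inC i) (inC j) = s₁ _ _
  S' (inC i) (inA p) = s₁ _ _
  S' (inA p) (inC i) = s₁ _ _
  S' (inA p) (inA p') = s₁ _ _
  S' (inC i) (inB q) = s₂ _ _
  S' (inB q) (inC i) = s₂ _ _
  S' (inB q) (inB q') = s₂ _ _
  S' (inA _) (inB _) = refl
  S' (inB _) (inA _) = refl
  S : ∀ x y → A x y ≡ A y x
  S x y = S' (toPart a₁ a₂ x) (toPart a₁ a₂ y)
  R' : ∀ (p : P) → glueAdjPart a₁ a₂ p p ≡ false
  R' (inC i) = r₁ _
  R' (inA p) = r₁ _
  R' (inB q) = r₂ _
  R : ∀ x → A x x ≡ false
  R x = R' (toPart a₁ a₂ x)

ClosedUnderSubstitution : Class → Set
ClosedUnderSubstitution 𝒢 =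
  ∀ (G₁ : Graph) {m} (e₁ : size G₁ ≡ suc m) (u : Fin (size G₁))
    (G₂ : Graph) {k} (e₂ : size G₂ ≡ suc k) →
  𝒢 G₁ → 𝒢 G₂ → 𝒢 (substitute G₁ e₁ u G₂ e₂)

data Closure (𝒢 : Class) : Graph → Set where
  base  : ∀ {G} → 𝒢 G → Closure 𝒢 G
  iso   : ∀ {G H} → Iso G H → Closure 𝒢 G → Closure 𝒢 H
  subst : ∀ (G₁ : Graph) {m} (e₁ : size G₁ ≡ suc m) (u : Fin (size G₁))
            (G₂ : Graph) {k} (e₂ : size G₂ ≡ suc k) →
          Closure 𝒢 G₁ → Closure 𝒢 G₂ → Closure 𝒢 (substitute G₁ e₁ u G₂ e₂)
  glueC : ∀ (G₁ : Graph) {c a} (e₁ : size G₁ ≡ c + suc a)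
            (G₂ : Graph) {b} (e₂ : size G₂ ≡ c + suc b) →
          IsCliqueOn G₁ {c} {suc a} e₁ → IsCliqueOn G₂ {c} {suc b} e₂ →
          Closure 𝒢 G₁ → Closure 𝒢 G₂ → Closure 𝒢 (glue G₁ e₁ G₂ e₂)

Colourable : Graph → ℕ → Set
Colourable G k = Σ (Fin (size G) → Fin k) λ col →
  ∀ i j → adj G i j ≡ true → col i ≢ col j

HasChromaticNumber : Graph → ℕ → Set
HasChromaticNumber G k = Colourable G k × (∀ j → Colourable G j → k ≤ j)

-- Colourings are weighted: a vertex of weight w v needs w v distinct colours. By induction on 𝒢^#, for
-- every positive weighting w of G there is an induced subgraph H ∈ 𝒢 all of whose w-colourings extend
-- to G, so that H and G have the same weighted chromatic number; weight 1 gives the theorem. Weights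
-- are what make substitution work: G₁[u ← G₂] needs as many colours as G₁ with u weighted by the
-- weighted chromatic number t of G₂. Given witnesses H₁ ⊆ G₁ and H₂ ⊆ G₂, if H₁ contains u then
-- H₁[u ← H₂] ∈ 𝒢 is a witness, since each of its colourings leaves at least t colours free for u;
-- otherwise H₁ itself is one. For a gluing along a clique, the witness of the side with the larger
-- chromatic number serves, because colourings of the two sides can be permuted to agree on the clique.

module Submission where

open import Defs renaming (sym to adj-symmetric; subst to substituted)
open import Data.Bool using (Bool; true; false) renaming (_≟_ to _≟ᵇ_)
open import Data.Empty using (⊥-elim)
open import Data.Fin using (Fin; zero; suc; toℕ; fromℕ<; combine; _↑ˡ_; _↑ʳ_; splitAt; join; punchIn; punchOut; _≟_)
open import Data.Fin.Base using (finToFun; funToFin)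
open import Data.Fin.Properties
  using (any?; all?; toℕ<n; toℕ-fromℕ<; fromℕ<-injective; toℕ-injective; combine-injective;
         toℕ-combine; finToFun-funToFin; punchInᵢ≢i; punchOut-cong; punchOut-punchIn; punchOut-injective;
         punchIn-injective; punchIn-punchOut; ↑ˡ-injective; splitAt-↑ˡ; splitAt-↑ʳ; splitAt⁻¹-↑ˡ;
         splitAt⁻¹-↑ʳ; splitAt-join; join-splitAt)
open import Data.List using (List; []; _∷_; allFin; upTo; cartesianProduct; filter)
open import Data.List.Membership.Propositional using (_∈_)
open import Data.List.Membership.Propositional.Properties
  using (∈-filter⁺; ∈-filter⁻; ∈-cartesianProduct⁺; ∈-allFin; ∈-upTo⁺)
open import Data.List.Relation.Unary.Any using (here; there)
open import Data.Maybe using (Maybe; just; nothing; maybe)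
open import Data.Nat
  using (ℕ; zero; suc; _+_; _*_; _^_; _⊔_; _≤_; _<_; _<?_; _≤′_; ≤′-refl; ≤′-step; z≤n; s≤s; z<s; s≤s⁻¹)
  renaming (_≟_ to _≟ℕ_)
open import Data.Nat.Induction using (<-rec)
open import Data.Nat.Properties
  using (≤-refl; ≤-reflexive; ≤-trans; <-trans; <-≤-trans; ≤-<-trans; ≤-total; ≮⇒≥; <⇒≱; <⇒≢; <-cmp;
         ≤⇒≤′; n≤1+n; m<n⇒m<1+n; ≤∧≢⇒<; m≤m⊔n; m≤n⊔m; anyUpTo?)
open import Data.Product using (Σ; ∃; ∃-syntax; _×_; _,_; proj₁; proj₂)
open import Data.Product.Properties using (×-≡,≡→≡)
open import Data.Sum using (_⊎_; inj₁; inj₂; [_,_]′)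
open import Data.Sum.Properties using (inj₁-injective; inj₂-injective)
open import Function using (_∘_; id; const)
open import Function.Bundles using (Inverse; Injection)
open import Function.Definitions using (Injective)
open import Function.Properties.Inverse using (↔⇒↣)
open import Relation.Binary.Definitions using (tri<; tri≈; tri>)
open import Relation.Binary.PropositionalEquality
  using (_≡_; _≢_; refl; sym; trans; cong; cong₂; subst; subst₂; module ≡-Reasoning)
open import Relation.Nullary using (Dec; yes; no; ¬_; contradiction)
open import Relation.Nullary.Decidable using (_×-dec_; _→-dec_; ¬?; map′)
open import Relation.Unary using (Decidable)

open ≡-Reasoning

-- Weighted colourings

-- Vertex v gets the w v distinct colours colour v 0, …, colour v (w v ∸ 1); other values are junk.
record WeightedColouring {V : Set} (E : V → V → Bool) (w : V → ℕ) (k : ℕ) : Set where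
  field
    colour           : V → ℕ → ℕ
    colour<          : ∀ v {α} → α < w v → colour v α < k
    colour-injective : ∀ v {α β} → α < w v → β < w v → colour v α ≡ colour v β → α ≡ β
    colour-proper    : ∀ {u v α β} → E u v ≡ true → α < w u → β < w v → colour u α ≢ colour v β
open WeightedColouring

module _ {V : Set} {E : V → V → Bool} {w : V → ℕ} {k : ℕ} where

  pullback : ∀ {V′ : Set} {E′ : V′ → V′ → Bool} {w′ : V′ → ℕ} (f : V′ → V) →
             (∀ {x y} → E′ x y ≡ true → E (f x) (f y) ≡ true) → (∀ x → w′ x ≤ w (f x)) →
             WeightedColouring E w k → WeightedColouring E′ w′ k
  pullback f hom w′≤ C = record
    { colour           = colour C ∘ f
    ; colour<          = λ x α< → colour< C (f x) (fits x α<)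
    ; colour-injective = λ x α< β< → colour-injective C (f x) (fits x α<) (fits x β<)
    ; colour-proper    = λ {x} {y} e α< β< → colour-proper C (hom e) (fits x α<) (fits y β<)
    }
    where
    fits : ∀ x {α} → α < _ → α < w (f x)
    fits x α< = <-≤-trans α< (w′≤ x)

  recolour : ∀ {k′} (π : ℕ → ℕ) (C : WeightedColouring E w k) →
             (∀ v {α} → α < w v → π (colour C v α) < k′) →
             (∀ {u v α β} → α < w u → β < w v →
                π (colour C u α) ≡ π (colour C v β) → colour C u α ≡ colour C v β) →
             WeightedColouring E w k′
  recolour π C π< π-injective = record
    { colour           = λ v → π ∘ colour C v
    ; colour<          = π<
    ; colour-injective = λ v α< β< → colour-injective C v α< β< ∘ π-injective α< β<
    ; colour-proper    = λ e α< β< → colour-proper C e α< β< ∘ π-injective α< β<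
    }

  raise : ∀ {k′} → k ≤ k′ → WeightedColouring E w k → WeightedColouring E w k′
  raise k≤k′ C = recolour id C (λ v α< → <-≤-trans (colour< C v α<) k≤k′) (λ _ _ → id)

restrict : ∀ {H G w k} (e : InducedSub H G) →
           WeightedColouring (adj G) w k → WeightedColouring (adj H) (w ∘ proj₁ e) k
restrict (f , _ , f-adj) = pullback f (λ {x} {y} e → trans (f-adj x y) e) (λ _ → ≤-refl)

clique-distinct : ∀ {V : Set} {E : V → V → Bool} {w : V → ℕ} {k c} (C : WeightedColouring E w k)
                  (ι : Fin c → V) → (∀ i j → i ≢ j → E (ι i) (ι j) ≡ true) →
                  ∀ {i j α β} → α < w (ι i) → β < w (ι j) →
                  colour C (ι i) α ≡ colour C (ι j) β → i ≡ j × α ≡ β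
clique-distinct C ι clique {i} {j} α< β< eq with i ≟ j
... | yes refl = refl , colour-injective C (ι i) α< β< eq
... | no i≢j   = ⊥-elim (colour-proper C (clique i j i≢j) α< β< eq)

emptyColouring : ∀ {E : Fin 0 → Fin 0 → Bool} {w} → WeightedColouring E w 0
emptyColouring = record { colour = λ () ; colour< = λ () ; colour-injective = λ () ; colour-proper = λ { {()} } }

InducedSub-trans : ∀ {F H G} → InducedSub F H → InducedSub H G → InducedSub F G
InducedSub-trans (f , f-injective , f-adj) (g , g-injective , g-adj) =
  g ∘ f , f-injective ∘ g-injective , λ x y → trans (g-adj (f x) (f y)) (f-adj x y)

Iso⇒InducedSub : ∀ {G H} → Iso G H → InducedSub G H
Iso⇒InducedSub (φ , φ-adj) = Inverse.to φ , Injection.injective (↔⇒↣ φ) , φ-adj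

iso-colouring : ∀ {G H w k} ((φ , _) : Iso G H) →
                WeightedColouring (adj G) (w ∘ Inverse.to φ) k → WeightedColouring (adj H) w k
iso-colouring {G} {H} {w} (φ , φ-adj) = pullback from
  (λ {x} {y} e → trans (sym (φ-adj (from x) (from y)))
                       (trans (cong₂ (adj H) (strictlyInverseˡ x) (strictlyInverseˡ y)) e))
  (λ x → ≤-reflexive (cong w (sym (strictlyInverseˡ x))))
  where open Inverse φ

fromColouring : ∀ G {k} → Colourable G k → WeightedColouring (adj G) (const 1) k
fromColouring G (c , proper) = record
  { colour           = λ v _ → toℕ (c v)
  ; colour<          = λ v _ → toℕ<n (c v)
  ; colour-injective = λ { v (s≤s z≤n) (s≤s z≤n) _ → refl }
  ; colour-proper    = λ {u} {v} e _ _ → proper u v e ∘ toℕ-injective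
  }

toColouring : ∀ G {k} → WeightedColouring (adj G) (const 1) k → Colourable G k
toColouring G C = (λ v → fromℕ< (colour< C v z<s)) ,
  λ u v e → colour-proper C e z<s z<s ∘ fromℕ<-injective _ _ _ _

-- Weighted chromatic numbers

Least : (ℕ → Set) → ℕ → Set
Least P t = P t × (∀ {s} → P s → t ≤ s)

WeightedChromaticNumber : (G : Graph) → (Fin (size G) → ℕ) → ℕ → Set
WeightedChromaticNumber G w = Least (WeightedColouring (adj G) w)

least : ∀ {P : ℕ → Set} → Decidable P → ∀ {n} → P n → ∃ (Least P)
least {P} P? {n} = <-rec (λ n → P n → ∃ (Least P)) step n
  where
  step : ∀ n → (∀ {m} → m < n → P m → ∃ (Least P)) → P n → ∃ (Least P)
  step n rec pn with anyUpTo? P? n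
  ... | yes (m , m<n , pm) = rec m<n pm
  ... | no none            = n , pn , λ {s} ps → ≮⇒≥ λ s<n → none (s , s<n , ps)

upper-bound : ∀ {n} (w : Fin n → ℕ) → ∃[ M ] (∀ v → w v < M)
upper-bound {zero}  w = 0 , λ ()
upper-bound {suc n} w with upper-bound (w ∘ suc)
... | M , w∘suc< = suc (w zero) ⊔ M , λ
  { zero    → m≤m⊔n (suc (w zero)) M
  ; (suc v) → <-≤-trans (w∘suc< v) (m≤n⊔m (suc (w zero)) M) }

someColouring : ∀ G w → ∃ (WeightedColouring (adj G) w)
someColouring G w = size G * M , record
  { colour           = colour′
  ; colour<          = λ v α< → subst (_< size G * M) (toℕ-slot v α<) (toℕ<n (slot v α<))
  ; colour-injective = λ v α< β< eq → proj₂ (slot-injective α< β< eq)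
  ; colour-proper    = λ e α< β< eq → adjacent⇒distinct e (proj₁ (slot-injective α< β< eq))
  }
  where
  M = proj₁ (upper-bound w)
  colour′ : Fin (size G) → ℕ → ℕ
  colour′ v α = M * toℕ v + α
  slot : ∀ v {α} → α < w v → Fin (size G * M)
  slot v α< = combine v (fromℕ< (<-trans α< (proj₂ (upper-bound w) v)))
  toℕ-slot : ∀ v {α} (α< : α < w v) → toℕ (slot v α<) ≡ colour′ v α
  toℕ-slot v α< = trans (toℕ-combine v _) (cong (M * toℕ v +_) (toℕ-fromℕ< _))
  slot-injective : ∀ {u v α β} (α< : α < w u) (β< : β < w v) →
                   colour′ u α ≡ colour′ v β → u ≡ v × α ≡ β
  slot-injective {u} {v} α< β< eq
    with refl , eq′ ← combine-injective u _ v _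
           (toℕ-injective (trans (toℕ-slot u α<) (trans eq (sym (toℕ-slot v β<)))))
    = refl , fromℕ<-injective _ _ _ _ eq′
  adjacent⇒distinct : ∀ {u v} → adj G u v ≡ true → u ≢ v
  adjacent⇒distinct {u} e refl with () ← trans (sym e) (irrefl G u)

anyΠ? : ∀ {n} {s : Fin n → ℕ} {P : ((i : Fin n) → Fin (s i)) → Set} →
        (∀ {f g} → (∀ i → f i ≡ g i) → P f → P g) → (∀ f → Dec (P f)) → Dec (∃ P)
anyΠ? {zero} {s} resp P? = map′ (empty ,_) (λ (f , p) → resp (λ ()) p) (P? empty)
  where
  empty : (i : Fin zero) → Fin (s i)
  empty ()
anyΠ? {suc n} {s} {P} resp P? =
  map′ (λ (x , f , p) → cons x f , p)
       (λ (f , p) → f zero , f ∘ suc , resp (λ { zero → refl ; (suc i) → refl }) p)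
       (any? λ x → anyΠ? (λ f≗g → resp λ { zero → refl ; (suc i) → f≗g i }) (P? ∘ cons x))
  where
  cons : Fin (s zero) → ((i : Fin n) → Fin (s (suc i))) → (i : Fin (suc n)) → Fin (s i)
  cons x f zero    = x
  cons x f (suc i) = f i

extendByZero : ∀ {m} → (Fin m → ℕ) → ℕ → ℕ
extendByZero {zero}  f _       = 0
extendByZero {suc m} f zero    = f zero
extendByZero {suc m} f (suc α) = extendByZero (f ∘ suc) α

extendByZero-toℕ : ∀ {m} (f : Fin m → ℕ) i → extendByZero f (toℕ i) ≡ f i
extendByZero-toℕ f zero    = refl
extendByZero-toℕ f (suc i) = extendByZero-toℕ (f ∘ suc) i

extendByZero-fromℕ< : ∀ {m} (f : Fin m → ℕ) {α} (α< : α < m) → extendByZero f α ≡ f (fromℕ< α<)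
extendByZero-fromℕ< f α< = trans (cong (extendByZero f) (sym (toℕ-fromℕ< α<))) (extendByZero-toℕ f _)

module _ (G : Graph) (w : Fin (size G) → ℕ) (k : ℕ) where

  private
    -- A colouring is coded by the colours of the slots of each vertex, read as a number in base k.
    Code : Set
    Code = (v : Fin (size G)) → Fin (k ^ w v)

    slotColour : Code → (v : Fin (size G)) → Fin (w v) → Fin k
    slotColour F v = finToFun (F v)

    Valid : Code → Set
    Valid F = (∀ v α β → slotColour F v α ≡ slotColour F v β → α ≡ β)
            × (∀ u v α β → adj G u v ≡ true → slotColour F u α ≢ slotColour F v β)

    valid? : ∀ F → Dec (Valid F)
    valid? F = all? (λ v → all? λ α → all? λ β → (slotColour F v α ≟ slotColour F v β) →-dec (α ≟ β))
         ×-dec all? (λ u → all? λ v → all? λ α → all? λ β →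
                   (adj G u v ≟ᵇ true) →-dec ¬? (slotColour F u α ≟ slotColour F v β))

    valid-resp : ∀ {F F′} → (∀ v → F v ≡ F′ v) → Valid F → Valid F′
    valid-resp F≗F′ (injective , proper) =
      (λ v α β → injective v α β ∘ subst (λ F → F α ≡ F β) (cong finToFun (sym (F≗F′ v)))) ,
      (λ u v α β e → proper u v α β e ∘ subst₂ (λ Fu Fv → Fu α ≡ Fv β)
                                          (cong finToFun (sym (F≗F′ u))) (cong finToFun (sym (F≗F′ v))))

    encode : WeightedColouring (adj G) w k → Σ Code Valid
    encode C = F , injective , proper
      where
      c : (v : Fin (size G)) → Fin (w v) → Fin k
      c v α = fromℕ< (colour< C v (toℕ<n α))
      F : Code
      F v = funToFin (c v)
      toℕ-slot : ∀ v α → toℕ (slotColour F v α) ≡ colour C v (toℕ α)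
      toℕ-slot v α = trans (cong toℕ (finToFun-funToFin (c v) α)) (toℕ-fromℕ< _)
      same-colour : ∀ {u v} α β → slotColour F u α ≡ slotColour F v β → colour C u (toℕ α) ≡ colour C v (toℕ β)
      same-colour α β eq = trans (sym (toℕ-slot _ α)) (trans (cong toℕ eq) (toℕ-slot _ β))
      injective : ∀ v α β → slotColour F v α ≡ slotColour F v β → α ≡ β
      injective v α β = toℕ-injective ∘ colour-injective C v (toℕ<n α) (toℕ<n β) ∘ same-colour α β
      proper : ∀ u v α β → adj G u v ≡ true → slotColour F u α ≢ slotColour F v β
      proper u v α β e = colour-proper C e (toℕ<n α) (toℕ<n β) ∘ same-colour α β

    decode : Σ Code Valid → WeightedColouring (adj G) w k
    decode (F , injective , proper) = record
      { colour           = colour′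
      ; colour<          = λ v α< → subst (_< k) (sym (colour-slot v α<)) (toℕ<n _)
      ; colour-injective = λ v α< β< →
          fromℕ<-injective _ _ α< β< ∘ injective v _ _ ∘ same-slot α< β<
      ; colour-proper    = λ e α< β< → proper _ _ _ _ e ∘ same-slot α< β<
      }
      where
      colour′ : Fin (size G) → ℕ → ℕ
      colour′ v = extendByZero (toℕ ∘ slotColour F v)
      colour-slot : ∀ v {α} (α< : α < w v) → colour′ v α ≡ toℕ (slotColour F v (fromℕ< α<))
      colour-slot v α< = extendByZero-fromℕ< (toℕ ∘ slotColour F v) α<
      same-slot : ∀ {u v α β} (α< : α < w u) (β< : β < w v) → colour′ u α ≡ colour′ v β →
                  slotColour F u (fromℕ< α<) ≡ slotColour F v (fromℕ< β<)
      same-slot α< β< eq = toℕ-injective (trans (sym (colour-slot _ α<)) (trans eq (colour-slot _ β<)))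

  weightedColourable? : Dec (WeightedColouring (adj G) w k)
  weightedColourable? = map′ decode encode (anyΠ? valid-resp valid?)

weightedChromaticNumber : ∀ G w → ∃ (WeightedChromaticNumber G w)
weightedChromaticNumber G w = least (weightedColourable? G w) (proj₂ (someColouring G w))

nonEmpty : ∀ G {w t} → WeightedChromaticNumber G w t → 0 < t → ∃[ n ] size G ≡ suc n
nonEmpty record { size = zero } (_ , least) 0<t = ⊥-elim (<⇒≱ 0<t (least emptyColouring))
nonEmpty record { size = suc n } _ _ = n , refl

fin⇒suc : ∀ {n} → Fin n → ∃[ n′ ] n ≡ suc n′
fin⇒suc {suc n} _ = n , refl

-- Counting and permuting colours

module Counting {P : ℕ → Set} (P? : Decidable P) where

  count : ℕ → ℕ
  count zero = 0
  count (suc n) with P? n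
  ... | yes _ = suc (count n)
  ... | no  _ = count n

  count-suc : ∀ n → count n ≤ count (suc n)
  count-suc n with P? n
  ... | yes _ = n≤1+n _
  ... | no  _ = ≤-refl

  count-step : ∀ {n} → P n → suc (count n) ≤ count (suc n)
  count-step {n} pn with P? n
  ... | yes _ = ≤-refl
  ... | no ¬pn = contradiction pn ¬pn

  count-mono : ∀ {m n} → m ≤ n → count m ≤ count n
  count-mono = go ∘ ≤⇒≤′
    where
    go : ∀ {m n} → m ≤′ n → count m ≤ count n
    go ≤′-refl       = ≤-refl
    go (≤′-step m≤n) = ≤-trans (go m≤n) (count-suc _)

  count-< : ∀ {m n} → P m → m < n → count m < count n
  count-< pm m<n = ≤-trans (count-step pm) (count-mono m<n)

  count-injective : ∀ {m n} → P m → P n → count m ≡ count n → m ≡ n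
  count-injective {m} {n} pm pn eq with <-cmp m n
  ... | tri< m<n _ _ = contradiction eq (<⇒≢ (count-< pm m<n))
  ... | tri≈ _ m≡n _ = m≡n
  ... | tri> _ _ n<m = contradiction (sym eq) (<⇒≢ (count-< pn n<m))

  select : ∀ n {i} → i < count n → ∃[ m ] m < n × P m × count m ≡ i
  select (suc n) {i} i< with P? n
  ... | no _ with m , m<n , pm , eq ← select n i< = m , m<n⇒m<1+n m<n , pm , eq
  ... | yes pn with i ≟ℕ count n
  ...   | yes refl = n , ≤-refl , pn , refl
  ...   | no i≢ with m , m<n , pm , eq ← select n (≤∧≢⇒< (s≤s⁻¹ i<) i≢) = m , m<n⇒m<1+n m<n , pm , eq

swap : ℕ → ℕ → ℕ → ℕ
swap a b z with z ≟ℕ a | z ≟ℕ b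
... | yes _ | _     = b
... | no _  | yes _ = a
... | no _  | no _  = z

swap-left : ∀ a b → swap a b a ≡ b
swap-left a b with a ≟ℕ a
... | yes _ = refl
... | no a≢a = contradiction refl a≢a

swap-fixes : ∀ {a b z} → (z ≡ a → z ≡ b) → (z ≡ b → z ≡ a) → swap a b z ≡ z
swap-fixes {a} {b} {z} ⇒b ⇒a with z ≟ℕ a | z ≟ℕ b
... | yes z≡a | _     = sym (⇒b z≡a)
... | no _    | yes z≡b = sym (⇒a z≡b)
... | no _    | no _  = refl

swap-right : ∀ a b → swap a b b ≡ a
swap-right a b with b ≟ℕ a | b ≟ℕ b
... | yes b≡a | _     = b≡a
... | no _    | yes _ = refl
... | no _    | no b≢b = contradiction refl b≢b

swap-involutive : ∀ a b z → swap a b (swap a b z) ≡ z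
swap-involutive a b z with z ≟ℕ a | z ≟ℕ b
... | yes refl | _        = swap-right z b
... | no _     | yes refl = swap-left a z
... | no z≢a   | no z≢b   = swap-fixes (λ z≡a → contradiction z≡a z≢a) (λ z≡b → contradiction z≡b z≢b)

swap-injective : ∀ a b → Injective _≡_ _≡_ (swap a b)
swap-injective a b {x} {y} eq =
  trans (sym (swap-involutive a b x)) (trans (cong (swap a b) eq) (swap-involutive a b y))

swap-< : ∀ {a b k} → a < k → b < k → ∀ {z} → z < k → swap a b z < k
swap-< {a} {b} a< b< {z} z< with z ≟ℕ a | z ≟ℕ b
... | yes _ | _     = b<
... | no _  | yes _ = a<
... | no _  | no _  = z<

module _ {S : Set} (g f : S → ℕ) {k : ℕ} where

  extendMatching : ∀ (L : List S) →
    (∀ {s} → s ∈ L → g s < k) → (∀ {s} → s ∈ L → f s < k) →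
    (∀ {s s′} → s ∈ L → s′ ∈ L → g s ≡ g s′ → f s ≡ f s′) →
    (∀ {s s′} → s ∈ L → s′ ∈ L → f s ≡ f s′ → g s ≡ g s′) →
    ∃[ π ] Injective _≡_ _≡_ π × (∀ {x} → x < k → π x < k) × (∀ {s} → s ∈ L → π (g s) ≡ f s)
  extendMatching [] _ _ _ _ = id , id , id , λ ()
  extendMatching (s ∷ L) g< f< g⇒f f⇒g
    with π , π-injective , π< , π∘g≡f ← extendMatching L (g< ∘ there) (f< ∘ there)
                                          (λ p q → g⇒f (there p) (there q)) (λ p q → f⇒g (there p) (there q))
    = swap a b ∘ π
    , π-injective ∘ swap-injective a b
    , swap-< (π< (g< (here refl))) (f< (here refl)) ∘ π<
    , λ { (here refl) → swap-left a b
        ; (there s′∈L) → trans (cong (swap a b) (π∘g≡f s′∈L)) (swap-fixes (⇒b s′∈L) (⇒a s′∈L)) }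
    where
    a = π (g s)
    b = f s
    ⇒b : ∀ {s′} → s′ ∈ L → f s′ ≡ a → f s′ ≡ b
    ⇒b s′∈L eq = g⇒f (there s′∈L) (here refl) (π-injective (trans (π∘g≡f s′∈L) eq))
    ⇒a : ∀ {s′} → s′ ∈ L → f s′ ≡ b → f s′ ≡ a
    ⇒a s′∈L eq = trans (sym (π∘g≡f s′∈L)) (cong π (f⇒g (there s′∈L) (here refl) eq))

-- Substitution

unpunch : ∀ {n} → Fin (suc n) → Maybe (Fin n) → Fin (suc n)
unpunch u nothing  = u
unpunch u (just i) = punchIn u i

punch : ∀ {n} → Fin (suc n) → Fin (suc n) → Maybe (Fin n)
punch u v with u ≟ v
... | yes _   = nothing
... | no u≢v  = just (punchOut u≢v)

punch-≢ : ∀ {n} {u v : Fin (suc n)} (u≢v : u ≢ v) → punch u v ≡ just (punchOut u≢v)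
punch-≢ {u = u} {v} u≢v with u ≟ v
... | yes u≡v  = contradiction u≡v u≢v
... | no _     = cong just (punchOut-cong u refl)

punch-self : ∀ {n} (u : Fin (suc n)) → punch u u ≡ nothing
punch-self u with u ≟ u
... | yes _   = refl
... | no u≢u  = contradiction refl u≢u

unpunch-punch : ∀ {n} (u v : Fin (suc n)) → unpunch u (punch u v) ≡ v
unpunch-punch u v with u ≟ v
... | yes u≡v  = u≡v
... | no u≢v   = punchIn-punchOut u≢v

punch-unpunch : ∀ {n} (u : Fin (suc n)) p → punch u (unpunch u p) ≡ p
punch-unpunch u nothing  = punch-self u
punch-unpunch u (just i) = trans (punch-≢ (punchInᵢ≢i u i ∘ sym)) (cong just (punchOut-punchIn u))

module Substitution {m k : ℕ}
    (adj₁ : Fin (suc m) → Fin (suc m) → Bool) (sym₁ : ∀ i j → adj₁ i j ≡ adj₁ j i)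
    (irrefl₁ : ∀ i → adj₁ i i ≡ false) (u : Fin (suc m))
    (adj₂ : Fin (suc k) → Fin (suc k) → Bool) (sym₂ : ∀ i j → adj₂ i j ≡ adj₂ j i)
    (irrefl₂ : ∀ i → adj₂ i i ≡ false) where

  G₁ G₂ G : Graph
  G₁ = record { size = suc m ; adj = adj₁ ; sym = sym₁ ; irrefl = irrefl₁ }
  G₂ = record { size = suc k ; adj = adj₂ ; sym = sym₂ ; irrefl = irrefl₂ }
  G  = substitute G₁ refl u G₂ refl

  outer : Fin m → Fin (m + suc k)
  outer i = i ↑ˡ suc k

  inner : Fin (suc k) → Fin (m + suc k)
  inner j = m ↑ʳ j

  E₁ : Maybe (Fin m) → Maybe (Fin m) → Bool
  E₁ p q = adj₁ (unpunch u p) (unpunch u q)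

  E : Fin m ⊎ Fin (suc k) → Fin m ⊎ Fin (suc k) → Bool
  E = substAdjSum adj₁ u adj₂

  module _ {wo : Fin m → ℕ} {wi : Fin (suc k) → ℕ} {t K : ℕ} where

    -- A colour α < t of G₂ stands for the α-th slot of u.
    expand : WeightedColouring E₁ (maybe wo t) K → WeightedColouring adj₂ wi t →
              WeightedColouring E [ wo , wi ]′ K
    expand C₁ C₂ = record
      { colour           = colour′
      ; colour<          = λ { (inj₁ i) α< → colour< C₁ (just i) α<
                             ; (inj₂ j) α< → colour< C₁ nothing (colour< C₂ j α<) }
      ; colour-injective = λ { (inj₁ i) α< β< → colour-injective C₁ (just i) α< β<
                             ; (inj₂ j) α< β< → colour-injective C₂ j α< β<
                                 ∘ colour-injective C₁ nothing (colour< C₂ j α<) (colour< C₂ j β<) }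
      ; colour-proper    = λ {p} {q} → proper p q
      }
      where
      colour′ : Fin m ⊎ Fin (suc k) → ℕ → ℕ
      colour′ (inj₁ i) = colour C₁ (just i)
      colour′ (inj₂ j) = colour C₁ nothing ∘ colour C₂ j
      proper : ∀ p q {α β} → E p q ≡ true → α < [ wo , wi ]′ p → β < [ wo , wi ]′ q →
               colour′ p α ≢ colour′ q β
      proper (inj₁ i) (inj₁ i′) e α< β< = colour-proper C₁ e α< β<
      proper (inj₁ i) (inj₂ j)  e α< β< = colour-proper C₁ e α< (colour< C₂ j β<)
      proper (inj₂ j) (inj₁ i)  e α< β< = colour-proper C₁ (trans (sym₁ u _) e) (colour< C₂ j α<) β<
      proper (inj₂ j) (inj₂ j′) e α< β< = colour-proper C₂ e α< β<
        ∘ colour-injective C₁ nothing (colour< C₂ j α<) (colour< C₂ j′ β<)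

    -- The colours on the copy of G₂ avoid those on the outer neighbours of u. Since G₂ needs t colours,
    -- there are at least t such free colours, and they are given to the slots of u.
    contract : (∀ {s} → WeightedColouring adj₂ wi s → t ≤ s) →
               WeightedColouring E [ wo , wi ]′ K → WeightedColouring E₁ (maybe wo t) K
    contract t-least C = record
      { colour           = colour′
      ; colour<          = λ { nothing α< → proj₁ (chosen-spec α<)
                             ; (just i) α< → colour< C (inj₁ i) α< }
      ; colour-injective = λ { nothing α< β< eq →
                                 trans (sym (chosen-rank α<)) (trans (cong count eq) (chosen-rank β<))
                             ; (just i) α< β< → colour-injective C (inj₁ i) α< β< }
      ; colour-proper    = λ {p} {q} → proper p q
      }
      where
      Blocked : ℕ → Set
      Blocked x = ∃[ i ] adj₁ (punchIn u i) u ≡ true × ∃[ β ] β < wo i × colour C (inj₁ i) β ≡ x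

      blocked? : ∀ x → Dec (Blocked x)
      blocked? x = any? λ i → (adj₁ (punchIn u i) u ≟ᵇ true)
                       ×-dec anyUpTo? (λ β → colour C (inj₁ i) β ≟ℕ x) (wo i)

      open Counting (¬? ∘ blocked?)

      inner-free : ∀ j {α} → α < wi j → ¬ Blocked (colour C (inj₂ j) α)
      inner-free j α< (i , e , β , β< , eq) = colour-proper C {inj₁ i} {inj₂ j} e β< α< eq

      inner-compressed : WeightedColouring adj₂ wi (count K)
      inner-compressed = recolour count (pullback inj₂ id (λ _ → ≤-refl) C)
        (λ j α< → count-< (inner-free j α<) (colour< C (inj₂ j) α<))
        (λ α< β< → count-injective (inner-free _ α<) (inner-free _ β<))

      pick : ∀ {α} → α < t → ∃[ x ] x < K × ¬ Blocked x × count x ≡ α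
      pick α< = select K (<-≤-trans α< (t-least inner-compressed))

      chosen : ℕ → ℕ
      chosen = extendByZero (λ α → proj₁ (pick (toℕ<n α)))

      chosen-spec : ∀ {α} (α< : α < t) → chosen α < K × ¬ Blocked (chosen α) × count (chosen α) ≡ α
      chosen-spec {α} α< with x< , free , rank ← proj₂ (pick (toℕ<n (fromℕ< α<))) =
        subst (λ y → y < K × ¬ Blocked y × count y ≡ α) (sym (extendByZero-fromℕ< _ α<))
              (x< , free , trans rank (toℕ-fromℕ< α<))

      chosen-rank : ∀ {α} (α< : α < t) → count (chosen α) ≡ α
      chosen-rank = proj₂ ∘ proj₂ ∘ chosen-spec

      colour′ : Maybe (Fin m) → ℕ → ℕ
      colour′ nothing  = chosen
      colour′ (just i) = colour C (inj₁ i)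

      proper : ∀ p q {α β} → E₁ p q ≡ true → α < maybe wo t p → β < maybe wo t q →
               colour′ p α ≢ colour′ q β
      proper nothing  nothing  e _ _ _ = contradiction (trans (sym e) (irrefl₁ u)) λ ()
      proper nothing  (just i) e α< β< eq =
        proj₁ (proj₂ (chosen-spec α<)) (i , trans (sym₁ _ u) e , _ , β< , sym eq)
      proper (just i) nothing  e α< β< eq =
        proj₁ (proj₂ (chosen-spec β<)) (i , e , _ , α< , eq)
      proper (just i) (just i′) e α< β< = colour-proper C {inj₁ i} {inj₁ i′} e α< β<

  join-weight : (w : Fin (m + suc k) → ℕ) → ∀ p → [ w ∘ outer , w ∘ inner ]′ p ≡ w (join m (suc k) p)
  join-weight w (inj₁ _) = refl
  join-weight w (inj₂ _) = refl

  module _ (w : Fin (m + suc k) → ℕ) (t : ℕ) where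

    -- The weight on G₁ for which u stands in for a copy of G₂ needing t colours.
    collapsedWeight : Fin (suc m) → ℕ
    collapsedWeight = maybe (w ∘ outer) t ∘ punch u

    substitute-colouring : ∀ {K} → WeightedColouring (adj G₁) collapsedWeight K →
                           WeightedColouring (adj G₂) (w ∘ inner) t → WeightedColouring (adj G) w K
    substitute-colouring C₁ C₂ = pullback (splitAt m) id split-≤ (expand (pullback (unpunch u) id unpunch-≤ C₁) C₂)
      where
      unpunch-≤ : ∀ p → maybe (w ∘ outer) t p ≤ collapsedWeight (unpunch u p)
      unpunch-≤ p = ≤-reflexive (cong (maybe (w ∘ outer) t) (sym (punch-unpunch u p)))
      split-≤ : ∀ x → w x ≤ [ w ∘ outer , w ∘ inner ]′ (splitAt m x)
      split-≤ x = ≤-reflexive (trans (cong w (sym (join-splitAt m (suc k) x))) (sym (join-weight w (splitAt m x))))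

    contract-colouring : (∀ {s} → WeightedColouring (adj G₂) (w ∘ inner) s → t ≤ s) →
                         ∀ {K} → WeightedColouring (adj G) w K → WeightedColouring (adj G₁) collapsedWeight K
    contract-colouring t-least C =
      pullback (punch u) punch-hom (λ _ → ≤-refl)
        (contract t-least (pullback (join m (suc k)) (λ {p} {q} → join-hom {p} {q}) (≤-reflexive ∘ join-weight w) C))
      where
      punch-hom : ∀ {x y} → adj₁ x y ≡ true → E₁ (punch u x) (punch u y) ≡ true
      punch-hom {x} {y} = subst₂ (λ a b → adj₁ a b ≡ true) (sym (unpunch-punch u x)) (sym (unpunch-punch u y))
      join-hom : ∀ {p q} → E p q ≡ true → adj G (join m (suc k) p) (join m (suc k) q) ≡ true
      join-hom {p} {q} = subst₂ (λ a b → E a b ≡ true) (sym (splitAt-join m (suc k) p)) (sym (splitAt-join m (suc k) q))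

    embed-avoiding : ∀ {H} (φ : InducedSub H G₁) → (∀ x → u ≢ proj₁ φ x) →
                     Σ (InducedSub H G) λ ψ → ∀ {K} →
                       WeightedColouring (adj H) (w ∘ proj₁ ψ) K →
                       WeightedColouring (adj H) (collapsedWeight ∘ proj₁ φ) K
    embed-avoiding {H} (f , f-injective , f-adj) avoid = (g , g-injective , g-adj) ,
      pullback id id (λ x → ≤-reflexive (cong (maybe (w ∘ outer) t) (punch-≢ (avoid x))))
      where
      g : Fin (size H) → Fin (m + suc k)
      g x = outer (punchOut (avoid x))
      g-injective : ∀ {x y} → g x ≡ g y → x ≡ y
      g-injective {x} {y} = f-injective ∘ punchOut-injective (avoid x) (avoid y) ∘ ↑ˡ-injective (suc k) _ _
      g-adj : ∀ x y → adj G (g x) (g y) ≡ adj H x y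
      g-adj x y = begin
        adj G (g x) (g y)
          ≡⟨ cong₂ E (splitAt-↑ˡ m _ (suc k)) (splitAt-↑ˡ m _ (suc k)) ⟩
        adj₁ (punchIn u (punchOut (avoid x))) (punchIn u (punchOut (avoid y)))
          ≡⟨ cong₂ adj₁ (punchIn-punchOut (avoid x)) (punchIn-punchOut (avoid y)) ⟩
        adj₁ (f x) (f y)
          ≡⟨ f-adj x y ⟩
        adj H x y ∎

module SubstitutionMonotone {m k : ℕ}
    (adj₁ : Fin (suc m) → Fin (suc m) → Bool) (sym₁ : ∀ i j → adj₁ i j ≡ adj₁ j i)
    (irrefl₁ : ∀ i → adj₁ i i ≡ false) (u : Fin (suc m))
    (adj₂ : Fin (suc k) → Fin (suc k) → Bool) (sym₂ : ∀ i j → adj₂ i j ≡ adj₂ j i)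
    (irrefl₂ : ∀ i → adj₂ i i ≡ false) (w : Fin (m + suc k) → ℕ) (t : ℕ) where

  open Substitution adj₁ sym₁ irrefl₁ u adj₂ sym₂ irrefl₂

  embed-substituted : ∀ (H₁ : Graph) {m′} (d₁ : size H₁ ≡ suc m′) (z : Fin (size H₁))
                        (H₂ : Graph) {k′} (d₂ : size H₂ ≡ suc k′)
                        (φ₁ : InducedSub H₁ G₁) (φ₂ : InducedSub H₂ G₂) → proj₁ φ₁ z ≡ u →
                      (∀ {s} → WeightedColouring (adj H₂) (w ∘ inner ∘ proj₁ φ₂) s → t ≤ s) →
                      Σ (InducedSub (substitute H₁ d₁ z H₂ d₂) G) λ ψ → ∀ {K} →
                        WeightedColouring (adj (substitute H₁ d₁ z H₂ d₂)) (w ∘ proj₁ ψ) K →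
                        WeightedColouring (adj H₁) (collapsedWeight w t ∘ proj₁ φ₁) K
  embed-substituted H₁ {m′} refl z H₂ {k′} refl
                    (f₁ , f₁-injective , f₁-adj) (f₂ , f₂-injective , f₂-adj) z↦u t-least =
    (g , g-injective , g-adj) ,
    λ C → pullback id id (λ x → ≤-reflexive (weight x)) (T.contract-colouring (w ∘ g) t t-least′ C)
    where
    module T = Substitution (adj H₁) (adj-symmetric H₁) (irrefl H₁) z (adj H₂) (adj-symmetric H₂) (irrefl H₂)

    avoid : ∀ i → u ≢ f₁ (punchIn z i)
    avoid i eq = punchInᵢ≢i z i (f₁-injective (trans (sym eq) (sym z↦u)))

    h : Fin m′ ⊎ Fin (suc k′) → Fin m ⊎ Fin (suc k)
    h (inj₁ i) = inj₁ (punchOut (avoid i))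
    h (inj₂ j) = inj₂ (f₂ j)

    h-injective : ∀ {p q} → h p ≡ h q → p ≡ q
    h-injective {inj₁ i} {inj₁ i′} eq =
      cong inj₁ (punchIn-injective z i i′
                  (f₁-injective (punchOut-injective (avoid i) (avoid i′) (inj₁-injective eq))))
    h-injective {inj₂ j} {inj₂ j′} eq = cong inj₂ (f₂-injective (inj₂-injective eq))

    outer-adj : ∀ i y → adj₁ (punchIn u (punchOut (avoid i))) (f₁ y) ≡ adj H₁ (punchIn z i) y
    outer-adj i y = trans (cong (λ v → adj₁ v (f₁ y)) (punchIn-punchOut (avoid i))) (f₁-adj _ y)

    h-adj : ∀ p q → E (h p) (h q) ≡ T.E p q
    h-adj (inj₁ i) (inj₁ i′) = trans (cong (adj₁ _) (punchIn-punchOut (avoid i′))) (outer-adj i _)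
    h-adj (inj₁ i) (inj₂ j)  = trans (cong (adj₁ _) (sym z↦u)) (outer-adj i z)
    h-adj (inj₂ j) (inj₁ i)  = trans (cong (adj₁ _) (sym z↦u)) (outer-adj i z)
    h-adj (inj₂ j) (inj₂ j′) = f₂-adj j j′

    g : Fin (m′ + suc k′) → Fin (m + suc k)
    g = join m (suc k) ∘ h ∘ splitAt m′

    splitAt-g : ∀ x → splitAt m (g x) ≡ h (splitAt m′ x)
    splitAt-g x = splitAt-join m (suc k) (h (splitAt m′ x))

    g-injective : ∀ {x y} → g x ≡ g y → x ≡ y
    g-injective {x} {y} eq = begin
      x                               ≡⟨ join-splitAt m′ (suc k′) x ⟨
      join m′ (suc k′) (splitAt m′ x) ≡⟨ cong (join m′ (suc k′)) (h-injective splitAt-eq) ⟩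
      join m′ (suc k′) (splitAt m′ y) ≡⟨ join-splitAt m′ (suc k′) y ⟩
      y                               ∎
      where
      splitAt-eq : h (splitAt m′ x) ≡ h (splitAt m′ y)
      splitAt-eq = trans (sym (splitAt-g x)) (trans (cong (splitAt m) eq) (splitAt-g y))

    g-adj : ∀ x y → adj G (g x) (g y) ≡ adj T.G x y
    g-adj x y = trans (cong₂ E (splitAt-g x) (splitAt-g y)) (h-adj (splitAt m′ x) (splitAt m′ y))

    t-least′ : ∀ {s} → WeightedColouring (adj H₂) (w ∘ g ∘ T.inner) s → t ≤ s
    t-least′ = t-least ∘ pullback id id λ j →
      ≤-reflexive (cong (w ∘ join m (suc k) ∘ h) (sym (splitAt-↑ʳ m′ (suc k′) j)))

    weight-unpunch : ∀ p → collapsedWeight w t (f₁ (unpunch z p)) ≡ maybe (w ∘ g ∘ T.outer) t p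
    weight-unpunch nothing  = cong (maybe (w ∘ outer) t) (trans (cong (punch u) z↦u) (punch-self u))
    weight-unpunch (just i) = begin
      maybe (w ∘ outer) t (punch u (f₁ (punchIn z i))) ≡⟨ cong (maybe (w ∘ outer) t) (punch-≢ (avoid i)) ⟩
      w (outer (punchOut (avoid i)))                   ≡⟨ cong (w ∘ join m (suc k) ∘ h) (splitAt-↑ˡ m′ i (suc k′)) ⟨
      w (g (T.outer i))                                ∎

    weight : ∀ x → collapsedWeight w t (f₁ x) ≡ T.collapsedWeight (w ∘ g) t x
    weight x = begin
      collapsedWeight w t (f₁ x)                       ≡⟨ cong (collapsedWeight w t ∘ f₁) (unpunch-punch z x) ⟨
      collapsedWeight w t (f₁ (unpunch z (punch z x))) ≡⟨ weight-unpunch (punch z x) ⟩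
      T.collapsedWeight (w ∘ g) t x                    ∎

-- Gluing along a clique

module Gluing {c a b : ℕ}
    (adj₁ : Fin (c + suc a) → Fin (c + suc a) → Bool) (sym₁ : ∀ i j → adj₁ i j ≡ adj₁ j i)
    (irrefl₁ : ∀ i → adj₁ i i ≡ false)
    (adj₂ : Fin (c + suc b) → Fin (c + suc b) → Bool) (sym₂ : ∀ i j → adj₂ i j ≡ adj₂ j i)
    (irrefl₂ : ∀ i → adj₂ i i ≡ false)
    (clique₁ : ∀ (i j : Fin c) → i ≢ j → adj₁ (i ↑ˡ suc a) (j ↑ˡ suc a) ≡ true)
    (clique₂ : ∀ (i j : Fin c) → i ≢ j → adj₂ (i ↑ˡ suc b) (j ↑ˡ suc b) ≡ true) where

  G₁ G₂ G : Graph
  G₁ = record { size = c + suc a ; adj = adj₁ ; sym = sym₁ ; irrefl = irrefl₁ }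
  G₂ = record { size = c + suc b ; adj = adj₂ ; sym = sym₂ ; irrefl = irrefl₂ }
  G  = glue G₁ refl G₂ refl

  P : Set
  P = Part adj₁ adj₂

  E : P → P → Bool
  E = glueAdjPart adj₁ adj₂

  toP : Fin (c + (suc a + suc b)) → P
  toP = toPart adj₁ adj₂

  fromP : P → Fin (c + (suc a + suc b))
  fromP (inC i) = i ↑ˡ (suc a + suc b)
  fromP (inA p) = c ↑ʳ (p ↑ˡ suc b)
  fromP (inB q) = c ↑ʳ (suc a ↑ʳ q)

  fromP-toP : ∀ x → fromP (toP x) ≡ x
  fromP-toP x with splitAt c x in eq
  ... | inj₁ i = splitAt⁻¹-↑ˡ eq
  ... | inj₂ y with splitAt (suc a) y in eq′
  ...   | inj₁ p = trans (cong (c ↑ʳ_) (splitAt⁻¹-↑ˡ eq′)) (splitAt⁻¹-↑ʳ eq)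
  ...   | inj₂ q = trans (cong (c ↑ʳ_) (splitAt⁻¹-↑ʳ eq′)) (splitAt⁻¹-↑ʳ eq)

  toP-fromP : ∀ p → toP (fromP p) ≡ p
  toP-fromP (inC i) rewrite splitAt-↑ˡ c i (suc a + suc b) = refl
  toP-fromP (inA p) rewrite splitAt-↑ʳ c (suc a + suc b) (p ↑ˡ suc b) | splitAt-↑ˡ (suc a) p (suc b) = refl
  toP-fromP (inB q) rewrite splitAt-↑ʳ c (suc a + suc b) (suc a ↑ʳ q) | splitAt-↑ʳ (suc a) (suc b) q = refl

  side₁ : Fin c ⊎ Fin (suc a) → P
  side₁ = [ inC , inA ]′

  side₂ : Fin c ⊎ Fin (suc b) → P
  side₂ = [ inC , inB ]′

  side₁-adj : ∀ p q → E (side₁ p) (side₁ q) ≡ adj₁ (join c (suc a) p) (join c (suc a) q)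
  side₁-adj (inj₁ _) (inj₁ _) = refl
  side₁-adj (inj₁ _) (inj₂ _) = refl
  side₁-adj (inj₂ _) (inj₁ _) = refl
  side₁-adj (inj₂ _) (inj₂ _) = refl

  -- On the common clique adj₁ and adj₂ agree, as both are complete there.
  side₂-adj : ∀ p q → E (side₂ p) (side₂ q) ≡ adj₂ (join c (suc b) p) (join c (suc b) q)
  side₂-adj (inj₁ i) (inj₁ j) with i ≟ j
  ... | yes refl = trans (irrefl₁ _) (sym (irrefl₂ _))
  ... | no i≢j   = trans (clique₁ i j i≢j) (sym (clique₂ i j i≢j))
  side₂-adj (inj₁ _) (inj₂ _) = refl
  side₂-adj (inj₂ _) (inj₁ _) = refl
  side₂-adj (inj₂ _) (inj₂ _) = refl

  side₁-injective : ∀ {p q} → side₁ p ≡ side₁ q → p ≡ q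
  side₁-injective {inj₁ _} {inj₁ _} refl = refl
  side₁-injective {inj₂ _} {inj₂ _} refl = refl

  side₂-injective : ∀ {p q} → side₂ p ≡ side₂ q → p ≡ q
  side₂-injective {inj₁ _} {inj₁ _} refl = refl
  side₂-injective {inj₂ _} {inj₂ _} refl = refl

  module Side {n : ℕ} (A : Fin (c + n) → Fin (c + n) → Bool) (s : Fin c ⊎ Fin n → P)
           (s-injective : ∀ {p q} → s p ≡ s q → p ≡ q)
           (s-adj : ∀ p q → E (s p) (s q) ≡ A (join c n p) (join c n q)) where

    embedSide : Fin (c + n) → Fin (c + (suc a + suc b))
    embedSide = fromP ∘ s ∘ splitAt c

    embedSide-injective : ∀ {x y} → embedSide x ≡ embedSide y → x ≡ y
    embedSide-injective {x} {y} eq = begin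
      x                      ≡⟨ join-splitAt c n x ⟨
      join c n (splitAt c x) ≡⟨ cong (join c n) (s-injective s-eq) ⟩
      join c n (splitAt c y) ≡⟨ join-splitAt c n y ⟩
      y                      ∎
      where
      s-eq : s (splitAt c x) ≡ s (splitAt c y)
      s-eq = trans (sym (toP-fromP (s (splitAt c x)))) (trans (cong toP eq) (toP-fromP (s (splitAt c y))))

    embedSide-adj : ∀ x y → adj G (embedSide x) (embedSide y) ≡ A x y
    embedSide-adj x y = begin
      E (toP (fromP (s (splitAt c x)))) (toP (fromP (s (splitAt c y))))
        ≡⟨ cong₂ E (toP-fromP (s (splitAt c x))) (toP-fromP (s (splitAt c y))) ⟩
      E (s (splitAt c x)) (s (splitAt c y))
        ≡⟨ s-adj (splitAt c x) (splitAt c y) ⟩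
      A (join c n (splitAt c x)) (join c n (splitAt c y))
        ≡⟨ cong₂ A (join-splitAt c n x) (join-splitAt c n y) ⟩
      A x y ∎

    fromSideColouring : ∀ {w K} → WeightedColouring A (w ∘ embedSide) K →
                        WeightedColouring (λ p q → E (s p) (s q)) (w ∘ fromP ∘ s) K
    fromSideColouring {w} = pullback (join c n) (λ {p} {q} e → trans (sym (s-adj p q)) e)
      (λ p → ≤-reflexive (cong (w ∘ fromP ∘ s) (sym (splitAt-join c n p))))

  module Side₁ = Side adj₁ side₁ side₁-injective side₁-adj
  module Side₂ = Side adj₂ side₂ side₂-injective side₂-adj

  embedding₁ : InducedSub G₁ G
  embedding₁ = Side₁.embedSide , Side₁.embedSide-injective , Side₁.embedSide-adj

  embedding₂ : InducedSub G₂ G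
  embedding₂ = Side₂.embedSide , Side₂.embedSide-injective , Side₂.embedSide-adj

  module _ (w : Fin (c + (suc a + suc b)) → ℕ) {K : ℕ} where

    SideColouring : ∀ {n} → (Fin c ⊎ Fin n → P) → Set
    SideColouring s = WeightedColouring (λ p q → E (s p) (s q)) (w ∘ fromP ∘ s) K

    AgreeOnClique : SideColouring side₁ → SideColouring side₂ → Set
    AgreeOnClique C₁ C₂ = ∀ i {α} → α < w (fromP (inC i)) → colour C₁ (inj₁ i) α ≡ colour C₂ (inj₁ i) α

    glue-colouring : (C₁ : SideColouring side₁) (C₂ : SideColouring side₂) → AgreeOnClique C₁ C₂ →
                     WeightedColouring (adj G) w K
    glue-colouring C₁ C₂ agree =
      pullback toP id (λ x → ≤-reflexive (cong w (sym (fromP-toP x)))) record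
        { colour           = colour′
        ; colour<          = λ { (inC i) → colour< C₁ (inj₁ i) ; (inA p) → colour< C₁ (inj₂ p)
                               ; (inB q) → colour< C₂ (inj₂ q) }
        ; colour-injective = λ { (inC i) → colour-injective C₁ (inj₁ i) ; (inA p) → colour-injective C₁ (inj₂ p)
                               ; (inB q) → colour-injective C₂ (inj₂ q) }
        ; colour-proper    = λ {p} {q} → proper p q
        }
      where
      colour′ : P → ℕ → ℕ
      colour′ (inC i) = colour C₁ (inj₁ i)
      colour′ (inA p) = colour C₁ (inj₂ p)
      colour′ (inB q) = colour C₂ (inj₂ q)
      proper : ∀ p q {α β} → E p q ≡ true → α < w (fromP p) → β < w (fromP q) → colour′ p α ≢ colour′ q β
      proper (inC i) (inC j)  e = colour-proper C₁ {inj₁ i} {inj₁ j} e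
      proper (inC i) (inA p)  e = colour-proper C₁ {inj₁ i} {inj₂ p} e
      proper (inA p) (inC i)  e = colour-proper C₁ {inj₂ p} {inj₁ i} e
      proper (inA p) (inA p′) e = colour-proper C₁ {inj₂ p} {inj₂ p′} e
      proper (inC i) (inB q)  e α< β< eq =
        colour-proper C₂ {inj₁ i} {inj₂ q} e α< β< (trans (sym (agree i α<)) eq)
      proper (inB q) (inC i)  e α< β< eq =
        colour-proper C₂ {inj₂ q} {inj₁ i} e α< β< (trans eq (agree i β<))
      proper (inB q) (inB q′) e = colour-proper C₂ {inj₂ q} {inj₂ q′} e
      proper (inA _) (inB _) ()
      proper (inB _) (inA _) ()

    -- The slots of the clique have pairwise distinct colours on both sides, so the colours of C₂
    -- can be permuted to match those of C₁ there.
    align : (C₁ : SideColouring side₁) → SideColouring side₂ → Σ (SideColouring side₂) (AgreeOnClique C₁)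
    align C₁ C₂ =
      recolour π C₂ (λ v → π< ∘ colour< C₂ v) (λ _ _ → π-injective) , λ i α< → sym (π∘g≡f (∈-slots α<))
      where
      W : Fin c → ℕ
      W i = w (fromP (inC i))
      isSlot? : ∀ (s : Fin c × ℕ) → Dec (proj₂ s < W (proj₁ s))
      isSlot? (i , α) = α <? W i
      candidates slots : List (Fin c × ℕ)
      candidates = cartesianProduct (allFin c) (upTo (proj₁ (upper-bound W)))
      slots = filter isSlot? candidates
      slot-valid : ∀ {i α} → (i , α) ∈ slots → α < W i
      slot-valid = proj₂ ∘ ∈-filter⁻ isSlot? {xs = candidates}
      ∈-slots : ∀ {i α} → α < W i → (i , α) ∈ slots
      ∈-slots {i} α< = ∈-filter⁺ isSlot?
        (∈-cartesianProduct⁺ (∈-allFin i) (∈-upTo⁺ (<-trans α< (proj₂ (upper-bound W) i)))) α<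
      g f : Fin c × ℕ → ℕ
      g (i , α) = colour C₂ (inj₁ i) α
      f (i , α) = colour C₁ (inj₁ i) α
      same-slot₁ : ∀ {s s′} → s ∈ slots → s′ ∈ slots → f s ≡ f s′ → s ≡ s′
      same-slot₁ s∈ s′∈ = ×-≡,≡→≡ ∘ clique-distinct C₁ inj₁ clique₁ (slot-valid s∈) (slot-valid s′∈)
      same-slot₂ : ∀ {s s′} → s ∈ slots → s′ ∈ slots → g s ≡ g s′ → s ≡ s′
      same-slot₂ s∈ s′∈ = ×-≡,≡→≡ ∘ clique-distinct C₂ inj₁ clique₁ (slot-valid s∈) (slot-valid s′∈)
      matching = extendMatching g f slots
        (λ s∈ → colour< C₂ (inj₁ _) (slot-valid s∈)) (λ s∈ → colour< C₁ (inj₁ _) (slot-valid s∈))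
        (λ s∈ s′∈ → cong f ∘ same-slot₂ s∈ s′∈) (λ s∈ s′∈ → cong g ∘ same-slot₁ s∈ s′∈)
      π = proj₁ matching
      π-injective = proj₁ (proj₂ matching)
      π< = proj₁ (proj₂ (proj₂ matching))
      π∘g≡f = proj₂ (proj₂ (proj₂ matching))

    glue-colourings : WeightedColouring (adj G₁) (w ∘ proj₁ embedding₁) K →
                      WeightedColouring (adj G₂) (w ∘ proj₁ embedding₂) K → WeightedColouring (adj G) w K
    glue-colourings C₁ C₂ = glue-colouring D₁ (proj₁ aligned) (proj₂ aligned)
      where
      D₁ : SideColouring side₁
      D₁ = Side₁.fromSideColouring {w} C₁
      aligned : Σ (SideColouring side₂) (AgreeOnClique D₁)
      aligned = align D₁ (Side₂.fromSideColouring {w} C₂)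

-- The closure 𝒢^#

module _ (𝒢 : Class) where

  record Witness (G : Graph) (w : Fin (size G) → ℕ) : Set where
    field
      H         : Graph
      H∈𝒢       : 𝒢 H
      embedding : InducedSub H G
      lift      : ∀ {K} → WeightedColouring (adj H) (w ∘ proj₁ embedding) K → WeightedColouring (adj G) w K

    χ : ℕ
    χ = proj₁ (weightedChromaticNumber H (w ∘ proj₁ embedding))

    χ-colouring : WeightedColouring (adj H) (w ∘ proj₁ embedding) χ
    χ-colouring = proj₁ (proj₂ (weightedChromaticNumber H (w ∘ proj₁ embedding)))

    χ-least : ∀ {s} → WeightedColouring (adj H) (w ∘ proj₁ embedding) s → χ ≤ s
    χ-least = proj₂ (proj₂ (weightedChromaticNumber H (w ∘ proj₁ embedding)))

  -- The weights are kept positive so that the witness for a substituted graph is non-empty.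
  Witnessed : Graph → Set
  Witnessed G = ∀ w → (∀ v → 0 < w v) → Witness G w

  colour-other : ∀ {G₁ w₁ G₂ w₂} (W₁ : Witness G₁ w₁) (W₂ : Witness G₂ w₂) →
                 Witness.χ W₂ ≤ Witness.χ W₁ → ∀ {K} →
                 WeightedColouring (adj (Witness.H W₁)) (w₁ ∘ proj₁ (Witness.embedding W₁)) K →
                 WeightedColouring (adj G₂) w₂ K
  colour-other W₁ W₂ χ₂≤χ₁ C =
    Witness.lift W₂ (raise (≤-trans χ₂≤χ₁ (Witness.χ-least W₁ C)) (Witness.χ-colouring W₂))

  widen : ∀ {G′ G w} (e : InducedSub G′ G) (W : Witness G′ (w ∘ proj₁ e)) →
          (∀ {K} → WeightedColouring (adj (Witness.H W)) (w ∘ proj₁ e ∘ proj₁ (Witness.embedding W)) K →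
                   WeightedColouring (adj G) w K) →
          Witness G w
  widen {G′} {G} e W lift′ = record
    { H = H ; H∈𝒢 = H∈𝒢 ; embedding = InducedSub-trans {H} {G′} {G} embedding e ; lift = lift′ }
    where open Witness W

  base-witnessed : ∀ {G} → 𝒢 G → Witnessed G
  base-witnessed {G} G∈𝒢 w _ = record { H = G ; H∈𝒢 = G∈𝒢 ; embedding = id , id , λ _ _ → refl ; lift = id }

  iso-witnessed : ∀ {G G′} → Iso G G′ → Witnessed G → Witnessed G′
  iso-witnessed {G} {G′} φ@(ψ , _) ok w w>0 =
    widen (Iso⇒InducedSub {G} {G′} φ) W (iso-colouring {G} {G′} {w} φ ∘ Witness.lift W)
    where W = ok (w ∘ Inverse.to ψ) (w>0 ∘ Inverse.to ψ)

  glue-witnessed : ∀ G₁ {c a} (e₁ : size G₁ ≡ c + suc a) G₂ {b} (e₂ : size G₂ ≡ c + suc b) →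
                   IsCliqueOn G₁ {c} {suc a} e₁ → IsCliqueOn G₂ {c} {suc b} e₂ →
                   Witnessed G₁ → Witnessed G₂ → Witnessed (glue G₁ e₁ G₂ e₂)
  glue-witnessed G₁ refl G₂ refl clique₁ clique₂ ok₁ ok₂ w w>0 = larger (≤-total (Witness.χ W₁) (Witness.χ W₂))
    where
    open Gluing (adj G₁) (adj-symmetric G₁) (irrefl G₁) (adj G₂) (adj-symmetric G₂) (irrefl G₂)
                clique₁ clique₂ hiding (G₁; G₂)
    W₁ = ok₁ (w ∘ proj₁ embedding₁) (w>0 ∘ proj₁ embedding₁)
    W₂ = ok₂ (w ∘ proj₁ embedding₂) (w>0 ∘ proj₁ embedding₂)
    larger : Witness.χ W₁ ≤ Witness.χ W₂ ⊎ Witness.χ W₂ ≤ Witness.χ W₁ → Witness G w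
    larger (inj₁ χ₁≤χ₂) =
      widen embedding₂ W₂ λ C → glue-colourings w (colour-other W₂ W₁ χ₁≤χ₂ C) (Witness.lift W₂ C)
    larger (inj₂ χ₂≤χ₁) =
      widen embedding₁ W₁ λ C → glue-colourings w (Witness.lift W₁ C) (colour-other W₁ W₂ χ₂≤χ₁ C)

  substitute-witnessed : ClosedUnderSubstitution 𝒢 →
                         ∀ G₁ {m} (e₁ : size G₁ ≡ suc m) u G₂ {k} (e₂ : size G₂ ≡ suc k) →
                         Witnessed G₁ → Witnessed G₂ → Witnessed (substitute G₁ e₁ u G₂ e₂)
  substitute-witnessed closed G₁ refl u G₂ refl ok₁ ok₂ w w>0 = byCases (any? λ z → proj₁ φ₁ z ≟ u)
    where
    open Substitution (adj G₁) (adj-symmetric G₁) (irrefl G₁) u (adj G₂) (adj-symmetric G₂) (irrefl G₂)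
      hiding (G₁; G₂)
    W₂ = ok₂ (w ∘ inner) (w>0 ∘ inner)
    open Witness W₂ using () renaming (H to H₂; embedding to φ₂; χ to t)
    C₂ : WeightedColouring (adj G₂) (w ∘ inner) t
    C₂ = Witness.lift W₂ (Witness.χ-colouring W₂)
    t>0 : 0 < t
    t>0 = ≤-<-trans z≤n (colour< C₂ zero (w>0 (inner zero)))
    positive : ∀ v → 0 < collapsedWeight w t v
    positive v with punch u v
    ... | nothing = t>0
    ... | just i  = w>0 (outer i)
    W₁ = ok₁ (collapsedWeight w t) positive
    open Witness W₁ using () renaming (H to H₁; embedding to φ₁)
    open SubstitutionMonotone (adj G₁) (adj-symmetric G₁) (irrefl G₁) u (adj G₂) (adj-symmetric G₂) (irrefl G₂)
                              w t

    finish : (H : Graph) → 𝒢 H →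
             Σ (InducedSub H G) (λ ψ → ∀ {K} → WeightedColouring (adj H) (w ∘ proj₁ ψ) K →
                                       WeightedColouring (adj H₁) (collapsedWeight w t ∘ proj₁ φ₁) K) →
             Witness G w
    finish H H∈𝒢 (ψ , transfer) = record
      { H = H ; H∈𝒢 = H∈𝒢 ; embedding = ψ
      ; lift = λ C → substitute-colouring w t (Witness.lift W₁ (transfer C)) C₂ }

    byCases : Dec (∃[ z ] proj₁ φ₁ z ≡ u) → Witness G w
    byCases (no u∉φ₁) =
      finish H₁ (Witness.H∈𝒢 W₁) (embed-avoiding w t {H₁} φ₁ λ x u≡ → u∉φ₁ (x , sym u≡))
    byCases (yes (z , z↦u)) =
      finish (substitute H₁ d₁ z H₂ d₂) (closed H₁ d₁ z H₂ d₂ (Witness.H∈𝒢 W₁) (Witness.H∈𝒢 W₂))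
             (embed-substituted H₁ d₁ z H₂ d₂ φ₁ φ₂ z↦u (Witness.χ-least W₂))
      where
      d₁ = proj₂ (fin⇒suc z)
      d₂ = proj₂ (nonEmpty H₂ (Witness.χ-colouring W₂ , Witness.χ-least W₂) t>0)

  closure-witnessed : ClosedUnderSubstitution 𝒢 → ∀ {G} → Closure 𝒢 G → Witnessed G
  closure-witnessed closed (base G∈𝒢) = base-witnessed G∈𝒢
  closure-witnessed closed (iso φ G∈#) = iso-witnessed φ (closure-witnessed closed G∈#)
  closure-witnessed closed (substituted G₁ e₁ u G₂ e₂ G₁∈# G₂∈#) =
    substitute-witnessed closed G₁ e₁ u G₂ e₂
      (closure-witnessed closed G₁∈#) (closure-witnessed closed G₂∈#)
  closure-witnessed closed (glueC G₁ e₁ G₂ e₂ clique₁ clique₂ G₁∈# G₂∈#) =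
    glue-witnessed G₁ e₁ G₂ e₂ clique₁ clique₂
      (closure-witnessed closed G₁∈#) (closure-witnessed closed G₂∈#)

lemma3p10 : (𝒢 : Class) → Hereditary 𝒢 → ClosedUnderSubstitution 𝒢 →
    ∀ (G : Graph) → Closure 𝒢 G →
    Σ Graph λ G' → 𝒢 G' × InducedSub G' G ×
    Σ ℕ λ k → HasChromaticNumber G' k × HasChromaticNumber G k
lemma3p10 𝒢 _ closed G G∈# =
  H , H∈𝒢 , embedding , χ ,
  (toColouring H χ-colouring , λ j → χ-least ∘ fromColouring H) ,
  (toColouring G (lift χ-colouring) , λ j → χ-least ∘ restrict {H} {G} embedding ∘ fromColouring G)
  where open Witness (closure-witnessed 𝒢 closed G∈# (const 1) (λ _ → z<s))
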